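{- Let $H$ be a 3-graph on $n$ vertices, $n$ even, and let $r=r(n)\ll n^{3/2}$. Construct $r$ independent digraphs $D_1,\dots,D_r$ from $H$ by Procedure 3. Then with probability $1-o(n^{ -1})$, every set of $4$ vertices of $H$ is condensed in at most $9$ of the $D_i$.
   Context: Procedure 3 on $H$: take a uniformly random ordering $v_1,\dots,v_n$ of the vertices, split into ordered pairs $(v_1,v_2),\dots,(v_{n-1},v_n)$; $D$ has these $n/2$ pairs as vertices, with a directed edge from $(v_i,v_{i+1})$ to $(v_j,v_{j+1})$ iff $\{v_i,v_{i+1},v_j\}$ and $\{v_{i+1},v_j,v_{j+1}\}$ are both edges of $H$. A set $S$ of 4 vertices of $H$ is condensed in $D$ if two of the ordered pairs forming the vertices of $D$ together contain all four vertices of $S$. $f\ll g$ means $f/g\to0$ as $n\to\infty$. -}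

module Defs where

open import Data.Nat using (ℕ; zero; suc; _+_; _*_; _≤ᵇ_)
open import Data.Bool using (Bool; true; false; _∧_; _∨_; not; if_then_else_)
open import Data.Fin using (Fin)
open import Data.Fin.Properties using (_≟_)
open import Data.Fin.Subset using (Subset; ∣_∣; ⁅_⁆; _∪_; _∈_)
open import Data.Product using (_×_; _,_; proj₁; proj₂)
open import Data.List using (List; []; _∷_; map; concatMap; filter; length; allFin)
open import Data.Bool.ListAction using (all; any)
open import Data.Vec using (Vec; []; _∷_; lookup; toList)
open import Relation.Nullary.Decidable using (⌊_⌋)
open import Relation.Binary.PropositionalEquality using (_≡_)

record ThreeGraph (n : ℕ) : Set₁ where
  field
    Edge     : Subset n → Set
    edgeSize : ∀ e → Edge e → ∣ e ∣ ≡ 3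
open ThreeGraph public

triple : ∀ {n} → Fin n → Fin n → Fin n → Subset n
triple a b c = ⁅ a ⁆ ∪ (⁅ b ⁆ ∪ ⁅ c ⁆)

-- Orderings of the n = 2m vertices, already split into the m consecutive
-- ordered pairs (v1,v2),(v3,v4),...,(v_{n-1},v_n).

Pairing : ℕ → Set
Pairing m = Vec (Fin (2 * m) × Fin (2 * m)) m

flatten : ∀ {n m} → Vec (Fin n × Fin n) m → List (Fin n)
flatten v = concatMap (λ p → proj₁ p ∷ proj₂ p ∷ []) (toList v)

memᵇ : ∀ {n} → Fin n → List (Fin n) → Bool
memᵇ x ys = any (λ y → ⌊ x ≟ y ⌋) ys

distinctᵇ : ∀ {n} → List (Fin n) → Bool
distinctᵇ []       = true
distinctᵇ (x ∷ xs) = not (memᵇ x xs) ∧ distinctᵇ xs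

isOrderingᵇ : ∀ {m} → Pairing m → Bool
isOrderingᵇ v = distinctᵇ (flatten v)

allVec : ∀ {A : Set} (k : ℕ) → List A → List (Vec A k)
allVec zero    xs = [] ∷ []
allVec (suc k) xs = concatMap (λ x → map (x ∷_) (allVec k xs)) xs

allPairs : ∀ {n} → List (Fin n × Fin n)
allPairs {n} = concatMap (λ a → map (a ,_) (allFin n)) (allFin n)

-- all orderings of the 2m vertices (each listed exactly once), so the
-- uniform random ordering is the uniform distribution on this list
orderings : (m : ℕ) → List (Pairing m)
orderings m = filter (λ v → Data.Bool._≟_ (isOrderingᵇ v) true) (allVec m allPairs)
  where import Data.Bool

record Digraph (n m : ℕ) : Set₁ where
  field
    vertex : Fin m → Fin n × Fin n
    arc    : Fin m → Fin m → Set
open Digraph public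

procedure3 : ∀ {m} → ThreeGraph (2 * m) → Pairing m → Digraph (2 * m) m
procedure3 H v = record
  { vertex = λ i → lookup v i
  ; arc    = λ i j →
      let (a , b) = lookup v i ; (c , d) = lookup v j in
      Edge H (triple a b c) × Edge H (triple b c d) }

coveredᵇ : ∀ {n} → Subset n → List (Fin n) → Bool
coveredᵇ {n} S ys = all (λ x → not (lookup S x) ∨ memᵇ x ys) (allFin n)

condensedᵇ : ∀ {n m} → Subset n → Digraph n m → Bool
condensedᵇ {n} {m} S D =
  any (λ i → any (λ j →
    coveredᵇ S (proj₁ (vertex D i) ∷ proj₂ (vertex D i) ∷
                proj₁ (vertex D j) ∷ proj₂ (vertex D j) ∷ []))
      (allFin m)) (allFin m)

countCondensed : ∀ {n m} → Subset n → List (Digraph n m) → ℕ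
countCondensed S []       = 0
countCondensed S (D ∷ Ds) = (if condensedᵇ S D then 1 else 0) + countCondensed S Ds

fourSets : (n : ℕ) → List (Subset n)
fourSets n = filter (λ S → ∣ S ∣ Data.Nat.≟ 4) (allVec n (true ∷ false ∷ []))
  where import Data.Nat

badᵇ : ∀ {m r} → ThreeGraph (2 * m) → Vec (Pairing m) r → Bool
badᵇ {m} H ps =
  any (λ S → 10 ≤ᵇ countCondensed S (map (procedure3 H) (toList ps)))
      (fourSets (2 * m))

-- sample space of r independent uniform orderings
tuples : (m r : ℕ) → List (Vec (Pairing m) r)
tuples m r = allVec r (orderings m)

badCount : ∀ m r → ThreeGraph (2 * m) → ℕ
badCount m r H = length (filter (λ t → Data.Bool._≟_ (badᵇ H t) true) (tuples m r))
  where import Data.Bool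

module Submission where

-- Probabilities are counts of outcomes in the finite sample spaces of
-- Defs.
--
-- 1. Whether a 4-set S is condensed depends only on the ordering, not on H.
--    For one uniform ordering and n ≥ 18, P(S condensed) ≤ 512/n², by an
--    injection: an ordering whose pairs (s,b), (c,d) cover S, together with
--    vertices x ∉ S and y ∉ S ∪ {x}, goes to the ordering with b ↔ x and
--    d ↔ y transposed, tagged with (s,b,c,d) ∈ S⁴.  In the image s and c
--    locate the pairs (s,x), (c,y), so the map is injective; and at least
--    n²/2 pairs (x , y) are admissible.
-- 2. In r independent trials of success probability ≤ K/Z, at least j
--    successes have probability ≤ (rK/Z)^j (induction on r).
-- 3. A union bound over the ≤ n⁴ four-sets with j = 10 gives
--    P(bad) ≤ n⁴ (512 r/n²)^10, which is o(1/n) when r² ≪ n³.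

open import Defs
open import Data.Nat using (ℕ; zero; suc; _+_; _*_; _^_; _≤_; _≥_; z≤n; s≤s; _≤ᵇ_; NonZero; >-nonZero)
import Data.Nat as ℕ
open import Data.Nat.Properties
open import Data.Nat.ListAction using (sum)
open import Data.Nat.Tactic.RingSolver using (solve-∀)
open import Data.Bool using (Bool; true; false; _∧_; _∨_; not; if_then_else_)
import Data.Bool as Bool
open import Data.Bool.Properties using (∧-conicalˡ; ∧-conicalʳ; ∨-conicalˡ; ∨-conicalʳ; not-involutive)
open import Data.Bool.ListAction using (any; all)
open import Data.List using (List; []; _∷_; map; concatMap; filter; length; allFin; _++_; cartesianProduct; tabulate)
open import Data.List.Properties using (length-++; length-map; length-tabulate; map-cong)
open import Data.List.Membership.Propositional using (_∈_; _∉_)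
open import Data.List.Membership.Propositional.Properties using (∈-filter⁻; ∈-filter⁺; ∈-map⁺; ∈-map⁻; ∈-++⁺ˡ; ∈-++⁺ʳ; ∈-++⁻; ∈-allFin; ∈-cartesianProduct⁺; ∈-cartesianProduct⁻)
open import Data.List.Relation.Unary.Any using (here; there; tail)
import Data.List.Relation.Unary.All as All
open import Data.List.Relation.Unary.AllPairs using ([]; _∷_)
open import Data.List.Relation.Unary.Unique.Propositional using (Unique)
open import Data.List.Relation.Unary.Unique.Propositional.Properties using (++⁺; map⁺; filter⁺; allFin⁺; cartesianProduct⁺)
open import Data.Vec using (Vec; []; _∷_; lookup; toList)
import Data.Vec as Vec
open import Data.Vec.Properties using (∷-injectiveʳ; lookup-map; lookup-zipWith; []=⇒lookup)
open import Data.Fin using (Fin; zero; suc)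
import Data.Fin.Properties as Fin
open import Data.Fin.Permutation.Components using (transpose; transpose-inverse)
open import Data.Fin.Subset using (Subset; ∣_∣; _∪_; ⁅_⁆)
open import Data.Fin.Subset.Properties using (x∈⁅x⁆; ∣⁅x⁆∣≡1)
open import Data.Product using (_×_; _,_; proj₁; proj₂; ∃; Σ)
open import Data.Sum using (_⊎_; inj₁; inj₂)
open import Data.Empty using (⊥; ⊥-elim)
open import Relation.Binary.PropositionalEquality
open import Relation.Nullary using (¬_; does; yes; no)
open import Relation.Nullary.Decidable using (dec-true; dec-false)
open import Relation.Unary using (Pred; Decidable)

count : ∀ {A : Set} → (A → Bool) → List A → ℕ
count f []       = 0
count f (x ∷ xs) = if f x then suc (count f xs) else count f xs

count-cong : ∀ {A : Set} {f g : A → Bool} → (∀ x → f x ≡ g x) → ∀ xs → count f xs ≡ count g xs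
count-cong e [] = refl
count-cong {g = g} e (x ∷ xs) rewrite e x = cong (λ k → if g x then suc k else k) (count-cong e xs)

length-filter : ∀ {A : Set} {ℓ} {P : Pred A ℓ} (P? : Decidable P) xs →
                length (filter P? xs) ≡ count (λ x → does (P? x)) xs
length-filter P? []       = refl
length-filter P? (x ∷ xs) with does (P? x)
... | true  = cong suc (length-filter P? xs)
... | false = length-filter P? xs

filterᵇ : ∀ {A : Set} → (A → Bool) → List A → List A
filterᵇ f = filter (λ x → f x Bool.≟ true)

length-filterᵇ : ∀ {A : Set} (f : A → Bool) xs → length (filterᵇ f xs) ≡ count f xs
length-filterᵇ f xs = trans (length-filter (λ x → f x Bool.≟ true) xs) (count-cong decides-f xs)
  where
    decides-f : ∀ x → does (f x Bool.≟ true) ≡ f x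
    decides-f x with f x
    ... | true  = refl
    ... | false = refl

count-true : ∀ {A : Set} (xs : List A) → count (λ _ → true) xs ≡ length xs
count-true []       = refl
count-true (x ∷ xs) = cong suc (count-true xs)

count-false : ∀ {A : Set} (xs : List A) → count (λ _ → false) xs ≡ 0
count-false []       = refl
count-false (x ∷ xs) = count-false xs

count-const : ∀ {A : Set} (b : Bool) (xs : List A) → count (λ _ → b) xs ≡ (if b then length xs else 0)
count-const true  xs = count-true xs
count-const false xs = count-false xs

count-++ : ∀ {A : Set} (f : A → Bool) xs ys → count f (xs ++ ys) ≡ count f xs + count f ys
count-++ f []       ys = refl
count-++ f (x ∷ xs) ys with f x
... | true  = cong suc (count-++ f xs ys)
... | false = count-++ f xs ys

count-map : ∀ {A C : Set} (f : C → Bool) (g : A → C) xs → count f (map g xs) ≡ count (λ x → f (g x)) xs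
count-map f g []       = refl
count-map f g (x ∷ xs) with f (g x)
... | true  = cong suc (count-map f g xs)
... | false = count-map f g xs

count-concatMap : ∀ {A C : Set} (f : C → Bool) (g : A → List C) xs →
                  count f (concatMap g xs) ≡ sum (map (λ x → count f (g x)) xs)
count-concatMap f g []       = refl
count-concatMap f g (x ∷ xs) =
  trans (count-++ f (g x) (concatMap g xs)) (cong (count f (g x) +_) (count-concatMap f g xs))

count-∨ : ∀ {A : Set} (f g : A → Bool) xs → count (λ x → f x ∨ g x) xs ≤ count f xs + count g xs
count-∨ f g []       = z≤n
count-∨ f g (x ∷ xs) with f x | g x
... | true  | true  = s≤s (≤-trans (count-∨ f g xs) (+-monoʳ-≤ (count f xs) (n≤1+n _)))
... | true  | false = s≤s (count-∨ f g xs)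
... | false | true  = ≤-trans (s≤s (count-∨ f g xs)) (≤-reflexive (sym (+-suc _ _)))
... | false | false = count-∨ f g xs

count-any : ∀ {A E : Set} (P : E → A → Bool) (F : List E) (L : List A) →
            count (λ t → any (λ e → P e t) F) L ≤ sum (map (λ e → count (P e) L) F)
count-any P []      L = ≤-reflexive (count-false L)
count-any P (e ∷ F) L = ≤-trans (count-∨ (P e) _ L) (+-monoʳ-≤ (count (P e) L) (count-any P F L))

count-complement : ∀ {A : Set} (f : A → Bool) xs → count f xs + count (λ x → not (f x)) xs ≡ length xs
count-complement f []       = refl
count-complement f (x ∷ xs) with f x
... | true  = cong suc (count-complement f xs)
... | false = trans (+-suc _ _) (cong suc (count-complement f xs))

sum-cong : ∀ {A : Set} {h h' : A → ℕ} → (∀ x → h x ≡ h' x) → ∀ xs → sum (map h xs) ≡ sum (map h' xs)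
sum-cong e xs = cong sum (map-cong e xs)

sum-const : ∀ {A : Set} (c : ℕ) (xs : List A) → sum (map (λ _ → c) xs) ≡ length xs * c
sum-const c []       = refl
sum-const c (x ∷ xs) = cong (c +_) (sum-const c xs)

sum-*ʳ : ∀ {A : Set} (h : A → ℕ) (z : ℕ) xs → sum (map h xs) * z ≡ sum (map (λ x → h x * z) xs)
sum-*ʳ h z []       = refl
sum-*ʳ h z (x ∷ xs) = trans (*-distribʳ-+ z (h x) (sum (map h xs))) (cong (h x * z +_) (sum-*ʳ h z xs))

sum-≤ : ∀ {A : Set} (h : A → ℕ) (B : ℕ) xs → (∀ x → x ∈ xs → h x ≤ B) → sum (map h xs) ≤ length xs * B
sum-≤ h B []       p = z≤n
sum-≤ h B (x ∷ xs) p = +-mono-≤ (p x (here refl)) (sum-≤ h B xs (λ y y∈xs → p y (there y∈xs)))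

sum-if : ∀ {A : Set} (f : A → Bool) (U V : ℕ) xs →
         sum (map (λ x → if f x then U else V) xs) ≤ count f xs * U + length xs * V
sum-if f U V []       = z≤n
sum-if f U V (x ∷ xs) with f x
... | true  = ≤-trans (+-monoʳ-≤ U (sum-if f U V xs))
                (≤-trans (≤-reflexive (sym (+-assoc U (count f xs * U) (length xs * V))))
                  (+-monoʳ-≤ (U + count f xs * U) (m≤n+m (length xs * V) V)))
... | false = ≤-trans (+-monoʳ-≤ V (sum-if f U V xs)) (≤-reflexive (exchange V (count f xs * U) (length xs * V)))
  where
    exchange : ∀ a b d → a + (b + d) ≡ b + (a + d)
    exchange = solve-∀

length-concatMap : ∀ {A C : Set} (g : A → List C) xs → length (concatMap g xs) ≡ sum (map (λ x → length (g x)) xs)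
length-concatMap g []       = refl
length-concatMap g (x ∷ xs) = trans (length-++ (g x)) (cong (length (g x) +_) (length-concatMap g xs))

length-cartesianProduct : ∀ {A C : Set} (xs : List A) (ys : List C) →
                          length (cartesianProduct xs ys) ≡ length xs * length ys
length-cartesianProduct []       ys = refl
length-cartesianProduct (x ∷ xs) ys =
  trans (length-++ (map (x ,_) ys)) (cong₂ _+_ (length-map (x ,_) ys) (length-cartesianProduct xs ys))

-- An injection from a duplicate-free list into ys forces length ≤ length ys;
-- it is proved by deleting the image of the head from ys.

remove : ∀ {A : Set} {x : A} (ys : List A) → x ∈ ys → List A
remove (y ∷ ys) (here _)  = ys
remove (y ∷ ys) (there p) = y ∷ remove ys p

length-remove : ∀ {A : Set} {x : A} (ys : List A) (p : x ∈ ys) → suc (length (remove ys p)) ≡ length ys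
length-remove (y ∷ ys) (here _)  = refl
length-remove (y ∷ ys) (there p) = cong suc (length-remove ys p)

∈-remove : ∀ {A : Set} {x z : A} (ys : List A) (p : x ∈ ys) → z ∈ ys → ¬ x ≡ z → z ∈ remove ys p
∈-remove (y ∷ ys) (here refl) (here refl) x≢z = ⊥-elim (x≢z refl)
∈-remove (y ∷ ys) (here refl) (there q)   x≢z = q
∈-remove (y ∷ ys) (there p)   (here refl) x≢z = here refl
∈-remove (y ∷ ys) (there p)   (there q)   x≢z = there (∈-remove ys p q x≢z)

-- The map may use the membership proof, so no choice function is needed.
injection-length : ∀ {A C : Set} {xs : List A} {ys : List C} → Unique xs →
  (f : ∀ {a} → a ∈ xs → C) → (∀ {a} (p : a ∈ xs) → f p ∈ ys) →
  (∀ {a b} (p : a ∈ xs) (q : b ∈ xs) → f p ≡ f q → a ≡ b) → length xs ≤ length ys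
injection-length {xs = []} _ f into injective = z≤n
injection-length {xs = x ∷ xs} {ys} (x∉xs ∷ unique) f into injective =
  ≤-trans (s≤s (injection-length unique (λ p → f (there p)) into-rest (λ p q → injective (there p) (there q))))
          (≤-reflexive (length-remove ys (into (here refl))))
  where
    into-rest : ∀ {a} (p : a ∈ xs) → f (there p) ∈ remove ys (into (here refl))
    into-rest p = ∈-remove ys (into (here refl)) (into (there p))
                    (λ e → All.lookup x∉xs p (injective (here refl) (there p) e))

true≢false : ¬ true ≡ false
true≢false ()

memᵇ-sound : ∀ {n} (x : Fin n) ys → memᵇ x ys ≡ true → x ∈ ys
memᵇ-sound x (y ∷ ys) e with x Fin.≟ y
... | yes refl = here refl
... | no _     = there (memᵇ-sound x ys e)

memᵇ-complete : ∀ {n} (x : Fin n) ys → x ∈ ys → memᵇ x ys ≡ true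
memᵇ-complete x (y ∷ ys) x∈ with x Fin.≟ y
... | yes _   = refl
... | no x≢y  = memᵇ-complete x ys (tail x≢y x∈)

all-sound : ∀ {A : Set} (f : A → Bool) xs {x} → all f xs ≡ true → x ∈ xs → f x ≡ true
all-sound f (y ∷ ys) e (here refl) = ∧-conicalˡ (f y) _ e
all-sound f (y ∷ ys) e (there x∈ys) = all-sound f ys (∧-conicalʳ (f y) _ e) x∈ys

any-sound : ∀ {A : Set} (f : A → Bool) xs → any f xs ≡ true → Σ A λ x → f x ≡ true
any-sound f (y ∷ ys) e with f y in fy
... | true  = y , fy
... | false = any-sound f ys e

distinctᵇ-∷ : ∀ {n} {a : Fin n} {l} → distinctᵇ (a ∷ l) ≡ true → a ∉ l × distinctᵇ l ≡ true
distinctᵇ-∷ {a = a} {l} d with memᵇ a l in a∈?l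
... | false = (λ a∈l → true≢false (trans (sym (memᵇ-complete a l a∈l)) a∈?l)) , d

length-allVec : ∀ {A : Set} k (xs : List A) → length (allVec k xs) ≡ length xs ^ k
length-allVec zero    xs = refl
length-allVec (suc k) xs = begin
  length (allVec (suc k) xs)
    ≡⟨ length-concatMap (λ x → map (x ∷_) (allVec k xs)) xs ⟩
  sum (map (λ x → length (map (x ∷_) (allVec k xs))) xs)
    ≡⟨ sum-cong (λ x → trans (length-map (x ∷_) (allVec k xs)) (length-allVec k xs)) xs ⟩
  sum (map (λ _ → length xs ^ k) xs)
    ≡⟨ sum-const (length xs ^ k) xs ⟩
  length xs * length xs ^ k ∎
  where open ≡-Reasoning

∈-concatMap⁻ : ∀ {A C : Set} (f : A → List C) xs {v} → v ∈ concatMap f xs → ∃ λ y → y ∈ xs × v ∈ f y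
∈-concatMap⁻ f (x ∷ xs) v∈ with ∈-++⁻ (f x) v∈
... | inj₁ v∈fx = x , here refl , v∈fx
... | inj₂ v∈rest with ∈-concatMap⁻ f xs v∈rest
...   | y , y∈xs , v∈fy = y , there y∈xs , v∈fy

∈-concatMap⁺ : ∀ {A C : Set} (f : A → List C) xs {v y} → y ∈ xs → v ∈ f y → v ∈ concatMap f xs
∈-concatMap⁺ f (x ∷ xs) (here refl) v∈fy = ∈-++⁺ˡ v∈fy
∈-concatMap⁺ f (x ∷ xs) (there y∈xs) v∈fy = ∈-++⁺ʳ (f x) (∈-concatMap⁺ f xs y∈xs v∈fy)

concatMap-unique : ∀ {A C : Set} (f : A → List C) (label : C → A) xs → Unique xs → (∀ x → Unique (f x)) →
                   (∀ x {z} → z ∈ f x → label z ≡ x) → Unique (concatMap f xs)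
concatMap-unique f label []       _                blocks labelled = []
concatMap-unique f label (x ∷ xs) (x∉xs ∷ unique) blocks labelled =
  ++⁺ (blocks x) (concatMap-unique f label xs unique blocks labelled) disjoint
  where
    disjoint : ∀ {v} → ¬ (v ∈ f x × v ∈ concatMap f xs)
    disjoint (v∈fx , v∈rest) with ∈-concatMap⁻ f xs v∈rest
    ... | y , y∈xs , v∈fy = All.lookup x∉xs y∈xs (trans (sym (labelled x v∈fx)) (labelled y v∈fy))

allVec-unique : ∀ {A : Set} k (xs : List A) → Unique xs → Unique (allVec k xs)
allVec-unique zero    xs _      = All.[] ∷ []
allVec-unique (suc k) xs unique = concatMap-unique (λ x → map (x ∷_) (allVec k xs)) Vec.head xs unique
  (λ x → map⁺ ∷-injectiveʳ (allVec-unique k xs unique))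
  (λ x v∈ → let (_ , _ , e) = ∈-map⁻ (x ∷_) v∈ in cong Vec.head e)

allVec-complete : ∀ {A : Set} {k} (xs : List A) (v : Vec A k) → (∀ i → lookup v i ∈ xs) → v ∈ allVec k xs
allVec-complete xs []      _      = here refl
allVec-complete xs (x ∷ v) inside = ∈-concatMap⁺ (λ x → map (x ∷_) (allVec _ xs)) xs (inside zero)
  (∈-map⁺ (x ∷_) (allVec-complete xs v (λ i → inside (suc i))))

allPairs-unique : ∀ {n} → Unique (allPairs {n})
allPairs-unique {n} = concatMap-unique (λ a → map (a ,_) (allFin n)) proj₁ (allFin n) (allFin⁺ n)
  (λ a → map⁺ (cong proj₂) (allFin⁺ n))
  (λ a p∈ → let (_ , _ , e) = ∈-map⁻ (a ,_) p∈ in cong proj₁ e)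

allPairs-complete : ∀ {n} (p : Fin n × Fin n) → p ∈ allPairs
allPairs-complete {n} (a , b) =
  ∈-concatMap⁺ (λ a → map (a ,_) (allFin n)) (allFin n) (∈-allFin a) (∈-map⁺ (a ,_) (∈-allFin b))

length-allFin : ∀ n → length (allFin n) ≡ n
length-allFin n = length-tabulate (λ i → i)

length-allPairs : ∀ n → length (allPairs {n}) ≡ n * n
length-allPairs n = begin
  length (allPairs {n})
    ≡⟨ length-concatMap (λ a → map (a ,_) (allFin n)) (allFin n) ⟩
  sum (map (λ a → length (map (a ,_) (allFin n))) (allFin n))
    ≡⟨ sum-cong (λ a → length-map (a ,_) (allFin n)) (allFin n) ⟩
  sum (map (λ _ → length (allFin n)) (allFin n))
    ≡⟨ sum-const (length (allFin n)) (allFin n) ⟩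
  length (allFin n) * length (allFin n)
    ≡⟨ cong₂ _*_ (length-allFin n) (length-allFin n) ⟩
  n * n ∎
  where open ≡-Reasoning

count-allPairs : ∀ {n} (f : Fin n × Fin n → Bool) →
                 count f allPairs ≡ sum (map (λ a → count (λ b → f (a , b)) (allFin n)) (allFin n))
count-allPairs {n} f = trans (count-concatMap f (λ a → map (a ,_) (allFin n)) (allFin n))
                             (sum-cong (λ a → count-map f (a ,_) (allFin n)) (allFin n))

orderings-unique : ∀ m → Unique (orderings m)
orderings-unique m = filter⁺ _ (allVec-unique m allPairs allPairs-unique)

∈-orderings⁺ : ∀ {m} (v : Pairing m) → isOrderingᵇ v ≡ true → v ∈ orderings m
∈-orderings⁺ v ordered =
  ∈-filter⁺ (λ v → isOrderingᵇ v Bool.≟ true) (allVec-complete allPairs v (λ i → allPairs-complete _)) ordered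

∈-orderings⁻ : ∀ {m} (v : Pairing m) → v ∈ orderings m → isOrderingᵇ v ≡ true
∈-orderings⁻ {m} v v∈ = proj₂ (∈-filter⁻ (λ v → isOrderingᵇ v Bool.≟ true) {xs = allVec m allPairs} v∈)

Covers : ∀ {n} → Subset n → List (Fin n) → Set
Covers S l = ∀ z → lookup S z ≡ true → z ∈ l

count-tabulate : ∀ {n} {C : Set} (h : Fin n → C) (f : C → Bool) (S : Subset n) →
                 (∀ i → f (h i) ≡ lookup S i) → count f (tabulate h) ≡ ∣ S ∣
count-tabulate {zero}  h f []      e = refl
count-tabulate {suc n} h f (b ∷ S) e with f (h zero) | e zero
... | true  | refl = cong suc (count-tabulate (λ i → h (suc i)) f S (λ i → e (suc i)))
... | false | refl = count-tabulate (λ i → h (suc i)) f S (λ i → e (suc i))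

count-lookup : ∀ {n} (S : Subset n) → count (lookup S) (allFin n) ≡ ∣ S ∣
count-lookup S = count-tabulate (λ i → i) (lookup S) S (λ i → refl)

elements : ∀ {n} → Subset n → List (Fin n)
elements {n} S = filterᵇ (lookup S) (allFin n)

length-elements : ∀ {n} (S : Subset n) → length (elements S) ≡ ∣ S ∣
length-elements {n} S = trans (length-filterᵇ (lookup S) (allFin n)) (count-lookup S)

∈-elements⁺ : ∀ {n} (S : Subset n) z → lookup S z ≡ true → z ∈ elements S
∈-elements⁺ S z z∈S = ∈-filter⁺ (λ x → lookup S x Bool.≟ true) (∈-allFin z) z∈S

∈-elements⁻ : ∀ {n} (S : Subset n) z → z ∈ elements S → lookup S z ≡ true
∈-elements⁻ {n} S z z∈ = proj₂ (∈-filter⁻ (λ x → lookup S x Bool.≟ true) {xs = allFin n} z∈)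

cover-size : ∀ {n} (S : Subset n) (l : List (Fin n)) → Covers S l → ∣ S ∣ ≤ length l
cover-size {n} S l covers = subst (_≤ length l) (length-elements S)
  (injection-length (filter⁺ _ (allFin⁺ n)) (λ {z} z∈ → z) (λ {z} z∈ → covers z (∈-elements⁻ S z z∈))
                    (λ _ _ e → e))

tight-cover : ∀ {n} (S : Subset n) {a} {l : List (Fin n)} → ∣ S ∣ ≡ suc (length l) →
              Covers S (a ∷ l) → lookup S a ≡ true × a ∉ l
tight-cover S {a} {l} size covers = head∈S , head∉tail
  where
    tail-covers : lookup S a ≡ false ⊎ a ∈ l → Covers S l
    tail-covers wasted z z∈S with covers z z∈S | wasted
    ... | here refl | inj₁ a∉S = ⊥-elim (true≢false (trans (sym z∈S) a∉S))
    ... | here refl | inj₂ a∈l = a∈l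
    ... | there z∈l | _        = z∈l
    too-small : lookup S a ≡ false ⊎ a ∈ l → ⊥
    too-small wasted = n≮n (length l) (subst (_≤ length l) size (cover-size S l (tail-covers wasted)))
    head∈S : lookup S a ≡ true
    head∈S with lookup S a in a?S
    ... | true  = refl
    ... | false = ⊥-elim (too-small (inj₁ a?S))
    head∉tail : a ∉ l
    head∉tail a∈l = too-small (inj₂ a∈l)

∣∪∣≤ : ∀ {n} (p q : Subset n) → ∣ p ∪ q ∣ ≤ ∣ p ∣ + ∣ q ∣
∣∪∣≤ []          []          = z≤n
∣∪∣≤ (true ∷ p)  (true ∷ q)  = s≤s (≤-trans (∣∪∣≤ p q) (+-monoʳ-≤ ∣ p ∣ (n≤1+n _)))
∣∪∣≤ (true ∷ p)  (false ∷ q) = s≤s (∣∪∣≤ p q)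
∣∪∣≤ (false ∷ p) (true ∷ q)  = ≤-trans (s≤s (∣∪∣≤ p q)) (≤-reflexive (sym (+-suc _ _)))
∣∪∣≤ (false ∷ p) (false ∷ q) = ∣∪∣≤ p q

bits : List Bool
bits = true ∷ false ∷ []

sizeIs : ∀ {n} → ℕ → Subset n → Bool
sizeIs k S = does (∣ S ∣ ℕ.≟ k)

count-subsets-∷ : ∀ n (f : Subset (suc n) → Bool) → count f (allVec (suc n) bits) ≡
  count (λ S → f (true ∷ S)) (allVec n bits) + count (λ S → f (false ∷ S)) (allVec n bits)
count-subsets-∷ n f = trans (count-concatMap f (λ x → map (x ∷_) (allVec n bits)) bits)
  (cong₂ _+_ (count-map f (true ∷_) (allVec n bits))
             (trans (+-identityʳ _) (count-map f (false ∷_) (allVec n bits))))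

count-sizeIs : ∀ n k → count (sizeIs k) (allVec n bits) ≤ n ^ k
count-sizeIs zero    zero    = ≤-refl
count-sizeIs zero    (suc k) = z≤n
count-sizeIs (suc n) zero    = begin
  count (sizeIs 0) (allVec (suc n) bits)          ≡⟨ count-subsets-∷ n (sizeIs 0) ⟩
  count (λ _ → false) (allVec n bits) + count (sizeIs 0) (allVec n bits)
                                                  ≡⟨ cong (_+ count (sizeIs 0) (allVec n bits)) (count-false (allVec n bits)) ⟩
  count (sizeIs 0) (allVec n bits)                ≤⟨ count-sizeIs n zero ⟩
  1 ∎
  where open ≤-Reasoning
count-sizeIs (suc n) (suc k) = begin
  count (sizeIs (suc k)) (allVec (suc n) bits)    ≡⟨ count-subsets-∷ n (sizeIs (suc k)) ⟩
  count (sizeIs k) (allVec n bits) + count (sizeIs (suc k)) (allVec n bits)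
                                                  ≤⟨ +-mono-≤ (count-sizeIs n k) (count-sizeIs n (suc k)) ⟩
  n ^ k + n * n ^ k                               ≤⟨ *-monoʳ-≤ (suc n) (^-monoˡ-≤ k (n≤1+n n)) ⟩
  suc n * suc n ^ k ∎
  where open ≤-Reasoning

length-fourSets : ∀ n → length (fourSets n) ≤ n ^ 4
length-fourSets n = ≤-trans (≤-reflexive (length-filter _ (allVec n bits))) (count-sizeIs n 4)

∈-fourSets⁻ : ∀ {n} S → S ∈ fourSets n → ∣ S ∣ ≡ 4
∈-fourSets⁻ {n} S S∈ = proj₂ (∈-filter⁻ (λ S → ∣ S ∣ ℕ.≟ 4) {xs = allVec n bits} S∈)

-- An r-tuple drawn from the list O is r independent uniform trials; a trial
-- x succeeds when `success x`.  If one trial succeeds with probability at most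
-- K/Z, then at least j successes among r trials have probability at most
-- (rK/Z)^j (choose which trial gives the next success).

module Trials {X : Set} (O : List X) (success : X → Bool) where

  successes : ∀ {r} → Vec X r → ℕ
  successes []      = 0
  successes (x ∷ t) = (if success x then 1 else 0) + successes t

  atLeast : ℕ → ℕ → ℕ
  atLeast r j = count (λ t → j ≤ᵇ successes t) (allVec r O)

  private
    ≤ᵇ-suc : ∀ j k → (suc j ≤ᵇ suc k) ≡ (j ≤ᵇ k)
    ≤ᵇ-suc zero    k = refl
    ≤ᵇ-suc (suc j) k = refl

  -- Condition on the first trial: a success leaves j more to find, a failure j+1.
  atLeast-step : ∀ r j → atLeast (suc r) (suc j) ≤ count success O * atLeast r j + length O * atLeast r (suc j)
  atLeast-step r j = begin
    atLeast (suc r) (suc j)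
      ≡⟨ count-concatMap _ _ O ⟩
    sum (map (λ x → count (λ t → suc j ≤ᵇ successes t) (map (x ∷_) (allVec r O))) O)
      ≡⟨ sum-cong (λ x → trans (count-map _ _ (allVec r O)) (first-trial x)) O ⟩
    sum (map (λ x → if success x then atLeast r j else atLeast r (suc j)) O)
      ≤⟨ sum-if success _ _ O ⟩
    count success O * atLeast r j + length O * atLeast r (suc j) ∎
    where
      open ≤-Reasoning
      first-trial : ∀ x → count (λ t → suc j ≤ᵇ successes (x ∷ t)) (allVec r O)
                          ≡ (if success x then atLeast r j else atLeast r (suc j))
      first-trial x with success x
      ... | true  = count-cong (λ t → ≤ᵇ-suc j (successes t)) (allVec r O)
      ... | false = refl

  tail-bound : ∀ Z K → count success O * Z ≤ K * length O →
               ∀ r j → atLeast r j * Z ^ j ≤ r ^ j * K ^ j * length O ^ r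
  tail-bound Z K p r zero = ≤-reflexive (begin
    atLeast r 0 * 1                 ≡⟨ *-identityʳ _ ⟩
    count (λ _ → true) (allVec r O) ≡⟨ count-true (allVec r O) ⟩
    length (allVec r O)             ≡⟨ length-allVec r O ⟩
    length O ^ r                    ≡⟨ sym (*-identityˡ _) ⟩
    1 * length O ^ r ∎)
    where open ≡-Reasoning
  tail-bound Z K p zero    (suc j) = z≤n
  tail-bound Z K p (suc r) (suc j) = begin
    atLeast (suc r) (suc j) * (Z * Z ^ j)
      ≤⟨ *-monoˡ-≤ (Z * Z ^ j) (atLeast-step r j) ⟩
    (a * atLeast r j + T * atLeast r (suc j)) * (Z * Z ^ j)
      ≡⟨ regroup a (atLeast r j) T (atLeast r (suc j)) Z (Z ^ j) ⟩
    (a * Z) * (atLeast r j * Z ^ j) + T * (atLeast r (suc j) * (Z * Z ^ j))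
      ≤⟨ +-mono-≤ (*-mono-≤ p (tail-bound Z K p r j)) (*-monoʳ-≤ T (tail-bound Z K p r (suc j))) ⟩
    (K * T) * (r ^ j * K ^ j * T ^ r) + T * ((r * r ^ j) * (K * K ^ j) * T ^ r)
      ≡⟨ collect K T (r ^ j) (K ^ j) (T ^ r) r ⟩
    (r ^ j + r * r ^ j) * (K * K ^ j) * (T * T ^ r)
      ≤⟨ *-monoˡ-≤ (T * T ^ r) (*-monoˡ-≤ (K * K ^ j) (*-monoʳ-≤ (suc r) (^-monoˡ-≤ j (n≤1+n r)))) ⟩
    (suc r * suc r ^ j) * (K * K ^ j) * (T * T ^ r) ∎
    where
      open ≤-Reasoning
      a T : ℕ
      a = count success O
      T = length O
      regroup : ∀ a A T B Z Zj → (a * A + T * B) * (Z * Zj) ≡ (a * Z) * (A * Zj) + T * (B * (Z * Zj))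
      regroup = solve-∀
      collect : ∀ K T rj Kj Tr r → (K * T) * (rj * Kj * Tr) + T * ((r * rj) * (K * Kj) * Tr)
                                   ≡ (rj + r * rj) * (K * Kj) * (T * Tr)
      collect = solve-∀

transpose-source : ∀ {n} (i j : Fin n) → transpose i j i ≡ j
transpose-source i j rewrite dec-true (i Fin.≟ i) refl = refl

transpose-target : ∀ {n} (i j : Fin n) → transpose i j j ≡ i
transpose-target i j with j Fin.≟ i
... | yes refl = refl
... | no _ rewrite dec-true (j Fin.≟ j) refl = refl

transpose-fixes : ∀ {n} (i j k : Fin n) → ¬ k ≡ i → ¬ k ≡ j → transpose i j k ≡ k
transpose-fixes i j k k≢i k≢j rewrite dec-false (k Fin.≟ i) k≢i | dec-false (k Fin.≟ j) k≢j = refl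

relabel : ∀ {n m} → (Fin n → Fin n) → Vec (Fin n × Fin n) m → Vec (Fin n × Fin n) m
relabel f = Vec.map (λ p → f (proj₁ p) , f (proj₂ p))

lookup-relabel : ∀ {n m} (f : Fin n → Fin n) (v : Vec (Fin n × Fin n) m) i →
                 lookup (relabel f v) i ≡ (f (proj₁ (lookup v i)) , f (proj₂ (lookup v i)))
lookup-relabel f v i = lookup-map i _ v

relabel-inverse : ∀ {n m} (f g : Fin n → Fin n) → (∀ z → g (f z) ≡ z) →
                  (v : Vec (Fin n × Fin n) m) → relabel g (relabel f v) ≡ v
relabel-inverse f g g∘f []            = refl
relabel-inverse f g g∘f ((a , b) ∷ v) = cong₂ _∷_ (cong₂ _,_ (g∘f a) (g∘f b)) (relabel-inverse f g g∘f v)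

flatten-relabel : ∀ {n m} (f : Fin n → Fin n) (v : Vec (Fin n × Fin n) m) → flatten (relabel f v) ≡ map f (flatten v)
flatten-relabel f []            = refl
flatten-relabel f ((a , b) ∷ v) = cong (λ l → f a ∷ f b ∷ l) (flatten-relabel f v)

memᵇ-map : ∀ {n} (f : Fin n → Fin n) → (∀ {x y} → f x ≡ f y → x ≡ y) → ∀ x ys → memᵇ (f x) (map f ys) ≡ memᵇ x ys
memᵇ-map f injective x []       = refl
memᵇ-map f injective x (y ∷ ys) with f x Fin.≟ f y | x Fin.≟ y
... | yes _     | yes _    = refl
... | yes fx≡fy | no x≢y   = ⊥-elim (x≢y (injective fx≡fy))
... | no fx≢fy  | yes refl = ⊥-elim (fx≢fy refl)
... | no _      | no _     = memᵇ-map f injective x ys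

distinctᵇ-map : ∀ {n} (f : Fin n → Fin n) → (∀ {x y} → f x ≡ f y → x ≡ y) → ∀ xs → distinctᵇ (map f xs) ≡ distinctᵇ xs
distinctᵇ-map f injective []       = refl
distinctᵇ-map f injective (x ∷ xs) = cong₂ (λ a b → not a ∧ b) (memᵇ-map f injective x xs) (distinctᵇ-map f injective xs)

isOrdering-relabel : ∀ {m} (f : Fin (2 * m) → Fin (2 * m)) → (∀ {x y} → f x ≡ f y → x ≡ y) →
                     (v : Pairing m) → isOrderingᵇ (relabel f v) ≡ isOrderingᵇ v
isOrdering-relabel f injective v = trans (cong distinctᵇ (flatten-relabel f v)) (distinctᵇ-map f injective (flatten v))

first-∈-flatten : ∀ {n m} (w : Vec (Fin n × Fin n) m) i → proj₁ (lookup w i) ∈ flatten w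
first-∈-flatten (p ∷ w) zero    = here refl
first-∈-flatten (p ∷ w) (suc i) = there (there (first-∈-flatten w i))

first-determines-pair : ∀ {n m} (w : Vec (Fin n × Fin n) m) → distinctᵇ (flatten w) ≡ true →
                        ∀ i i' → proj₁ (lookup w i) ≡ proj₁ (lookup w i') → i ≡ i'
first-determines-pair (p ∷ w) distinct zero    zero     e = refl
first-determines-pair (p ∷ w) distinct zero    (suc i') e =
  ⊥-elim (proj₁ (distinctᵇ-∷ distinct) (there (subst (_∈ flatten w) (sym e) (first-∈-flatten w i'))))
first-determines-pair (p ∷ w) distinct (suc i) zero     e =
  ⊥-elim (proj₁ (distinctᵇ-∷ distinct) (there (subst (_∈ flatten w) e (first-∈-flatten w i))))
first-determines-pair (p ∷ w) distinct (suc i) (suc i') e =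
  cong suc (first-determines-pair w rest-distinct i i' e)
  where
    rest-distinct : distinctᵇ (flatten w) ≡ true
    rest-distinct = proj₂ (distinctᵇ-∷ {a = proj₂ p} {flatten w} (proj₂ (distinctᵇ-∷ {a = proj₁ p} {proj₂ p ∷ flatten w} distinct)))

pairsAt : ∀ {m} → Pairing m → Fin m → Fin m → List (Fin (2 * m))
pairsAt v i j = proj₁ (lookup v i) ∷ proj₂ (lookup v i) ∷ proj₁ (lookup v j) ∷ proj₂ (lookup v j) ∷ []

condensedᵖ : ∀ {m} → Subset (2 * m) → Pairing m → Bool
condensedᵖ {m} S v = any (λ i → any (λ j → coveredᵇ S (pairsAt v i j)) (allFin m)) (allFin m)

condensed-procedure3 : ∀ {m} (H : ThreeGraph (2 * m)) (S : Subset (2 * m)) (v : Pairing m) →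
                       condensedᵇ S (procedure3 H v) ≡ condensedᵖ S v
condensed-procedure3 H S v = refl

covered-sound : ∀ {n} (S : Subset n) ys → coveredᵇ S ys ≡ true → Covers S ys
covered-sound {n} S ys covered z z∈S
  with all-sound (λ x → not (lookup S x) ∨ memᵇ x ys) (allFin n) covered (∈-allFin z)
... | z-covered rewrite z∈S = memᵇ-sound z ys z-covered

condensed-sound : ∀ {m} (S : Subset (2 * m)) v → condensedᵖ S v ≡ true → ∃ λ i → ∃ λ j → Covers S (pairsAt v i j)
condensed-sound {m} S v condensed with any-sound _ (allFin m) condensed
... | i , at-i with any-sound _ (allFin m) at-i
...   | j , at-ij = i , j , covered-sound S (pairsAt v i j) at-ij

record FourOf {n} (S : Subset n) (s b c d : Fin n) : Set where
  field
    s∈S : lookup S s ≡ true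
    b∈S : lookup S b ≡ true
    c∈S : lookup S c ≡ true
    d∈S : lookup S d ≡ true
    s≢b : ¬ s ≡ b
    s≢c : ¬ s ≡ c
    s≢d : ¬ s ≡ d
    b≢c : ¬ b ≡ c
    b≢d : ¬ b ≡ d
    c≢d : ¬ c ≡ d

bring-forward : ∀ {A : Set} (xs : List A) {a ys z} → z ∈ xs ++ a ∷ ys → z ∈ a ∷ xs ++ ys
bring-forward []       z∈ = z∈
bring-forward (x ∷ xs) (here z≡x) = there (here z≡x)
bring-forward (x ∷ xs) (there z∈) with bring-forward xs z∈
... | here z≡a   = here z≡a
... | there z∈xs = there (there z∈xs)

four-of-cover : ∀ {n} (S : Subset n) → ∣ S ∣ ≡ 4 → ∀ {s b c d} → Covers S (s ∷ b ∷ c ∷ d ∷ []) → FourOf S s b c d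
four-of-cover S size {s} {b} {c} {d} covers = record
  { s∈S = proj₁ at-s ; b∈S = proj₁ at-b ; c∈S = proj₁ at-c ; d∈S = proj₁ at-d
  ; s≢b = λ e → proj₂ at-s (here e)
  ; s≢c = λ e → proj₂ at-s (there (here e))
  ; s≢d = λ e → proj₂ at-s (there (there (here e)))
  ; b≢c = λ e → proj₂ at-b (there (here e))
  ; b≢d = λ e → proj₂ at-b (there (there (here e)))
  ; c≢d = λ e → proj₂ at-c (there (there (here e))) }
  where
    -- each entry is the head of a rearranged tight cover
    at : ∀ xs {a ys} → Covers S (xs ++ a ∷ ys) → ∣ S ∣ ≡ suc (length (xs ++ ys)) →
         lookup S a ≡ true × a ∉ xs ++ ys
    at xs covers′ size′ = tight-cover S size′ (λ z z∈S → bring-forward xs (covers′ z z∈S))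
    at-s : lookup S s ≡ true × s ∉ b ∷ c ∷ d ∷ []
    at-s = at [] covers size
    at-b : lookup S b ≡ true × b ∉ s ∷ c ∷ d ∷ []
    at-b = at (s ∷ []) covers size
    at-c : lookup S c ≡ true × c ∉ s ∷ b ∷ d ∷ []
    at-c = at (s ∷ b ∷ []) covers size
    at-d : lookup S d ≡ true × d ∉ s ∷ b ∷ c ∷ []
    at-d = at (s ∷ b ∷ c ∷ []) covers size

inside≢outside : ∀ {n} (S : Subset n) {u w} → lookup S u ≡ true → lookup S w ≡ false → ¬ u ≡ w
inside≢outside S u∈S w∉S refl = true≢false (trans (sym u∈S) w∉S)

excluded admissible : ∀ {n} → Subset n → Fin n × Fin n → Bool
excluded S p = lookup S (proj₁ p) ∨ lookup (S ∪ ⁅ proj₁ p ⁆) (proj₂ p)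
admissible S p = not (excluded S p)

admissible-sound : ∀ {n} (S : Subset n) x y → admissible S (x , y) ≡ true →
                   lookup S x ≡ false × lookup S y ≡ false × ¬ y ≡ x
admissible-sound S x y adm = ∨-conicalˡ _ _ not-excluded , ∨-conicalˡ _ _ y∉S∪x , y≢x
  where
    not-excluded : excluded S (x , y) ≡ false
    not-excluded = trans (sym (not-involutive _)) (cong not adm)
    y∉S∪x : (lookup S y ∨ lookup ⁅ x ⁆ y) ≡ false
    y∉S∪x = trans (sym (lookup-zipWith _∨_ y S ⁅ x ⁆)) (∨-conicalʳ _ _ not-excluded)
    y≢x : ¬ y ≡ x
    y≢x y≡x = true≢false (trans (sym ([]=⇒lookup (x∈⁅x⁆ x)))
                                (subst (λ z → lookup ⁅ x ⁆ z ≡ false) y≡x (∨-conicalʳ _ _ y∉S∪x)))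

excluded-first : ∀ {n} (S : Subset n) → count (λ p → lookup S (proj₁ p)) allPairs ≤ ∣ S ∣ * n
excluded-first {n} S = begin
  count (λ p → lookup S (proj₁ p)) allPairs
    ≡⟨ count-allPairs (λ p → lookup S (proj₁ p)) ⟩
  sum (map (λ a → count (λ _ → lookup S a) (allFin n)) (allFin n))
    ≡⟨ sum-cong (λ a → count-const (lookup S a) (allFin n)) (allFin n) ⟩
  sum (map (λ a → if lookup S a then length (allFin n) else 0) (allFin n))
    ≤⟨ sum-if (lookup S) (length (allFin n)) 0 (allFin n) ⟩
  count (lookup S) (allFin n) * length (allFin n) + length (allFin n) * 0
    ≡⟨ cong₂ (λ k l → k * l + l * 0) (count-lookup S) (length-allFin n) ⟩
  ∣ S ∣ * n + n * 0
    ≡⟨ trans (cong (∣ S ∣ * n +_) (*-zeroʳ n)) (+-identityʳ _) ⟩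
  ∣ S ∣ * n ∎
  where open ≤-Reasoning

excluded-second : ∀ {n} (S : Subset n) → count (λ p → lookup (S ∪ ⁅ proj₁ p ⁆) (proj₂ p)) allPairs ≤ n * suc ∣ S ∣
excluded-second {n} S = begin
  count (λ p → lookup (S ∪ ⁅ proj₁ p ⁆) (proj₂ p)) allPairs
    ≡⟨ count-allPairs (λ p → lookup (S ∪ ⁅ proj₁ p ⁆) (proj₂ p)) ⟩
  sum (map (λ a → count (lookup (S ∪ ⁅ a ⁆)) (allFin n)) (allFin n))
    ≡⟨ sum-cong (λ a → count-lookup (S ∪ ⁅ a ⁆)) (allFin n) ⟩
  sum (map (λ a → ∣ S ∪ ⁅ a ⁆ ∣) (allFin n))
    ≤⟨ sum-≤ (λ a → ∣ S ∪ ⁅ a ⁆ ∣) (suc ∣ S ∣) (allFin n) (λ a _ → one-more a) ⟩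
  length (allFin n) * suc ∣ S ∣
    ≡⟨ cong (_* suc ∣ S ∣) (length-allFin n) ⟩
  n * suc ∣ S ∣ ∎
  where
    open ≤-Reasoning
    one-more : ∀ a → ∣ S ∪ ⁅ a ⁆ ∣ ≤ suc ∣ S ∣
    one-more a = ≤-trans (∣∪∣≤ S ⁅ a ⁆) (≤-reflexive (trans (cong (∣ S ∣ +_) (∣⁅x⁆∣≡1 a)) (+-comm ∣ S ∣ 1)))

admissible-many : ∀ {n} (S : Subset n) → n * n ≤ (∣ S ∣ * n + n * suc ∣ S ∣) + count (admissible S) allPairs
admissible-many {n} S = begin
  n * n                 ≡⟨ sym (length-allPairs n) ⟩
  length (allPairs {n}) ≡⟨ sym (count-complement (excluded S) allPairs) ⟩
  count (excluded S) allPairs + count (admissible S) allPairs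
    ≤⟨ +-monoˡ-≤ _ (≤-trans (count-∨ (λ p → lookup S (proj₁ p)) (λ p → lookup (S ∪ ⁅ proj₁ p ⁆) (proj₂ p)) allPairs)
                            (+-mono-≤ (excluded-first S) (excluded-second S))) ⟩
  (∣ S ∣ * n + n * suc ∣ S ∣) + count (admissible S) allPairs ∎
  where open ≤-Reasoning

module CondensedOrderings (m : ℕ) (S : Subset (2 * m)) (|S|≡4 : ∣ S ∣ ≡ 4) where

  n : ℕ
  n = 2 * m

  -- the four vertices s, b, c, d of the two covering pairs
  Tag : Set
  Tag = Fin n × Fin n × Fin n × Fin n

  Domain : List (Pairing m × (Fin n × Fin n))
  Domain = cartesianProduct (filterᵇ (condensedᵖ S) (orderings m)) (filterᵇ (admissible S) allPairs)

  Codomain : List (Pairing m × Tag)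
  Codomain = cartesianProduct (orderings m)
               (cartesianProduct (elements S) (cartesianProduct (elements S) (cartesianProduct (elements S) (elements S))))

  record Witness (v : Pairing m) (x y : Fin n) : Set where
    field
      i j     : Fin m
      ordered : isOrderingᵇ v ≡ true
      four    : FourOf S (proj₁ (lookup v i)) (proj₂ (lookup v i)) (proj₁ (lookup v j)) (proj₂ (lookup v j))
      x∉S     : lookup S x ≡ false
      y∉S     : lookup S y ≡ false
      y≢x     : ¬ y ≡ x

  witness : ∀ {v x y} → (v , x , y) ∈ Domain → Witness v x y
  witness {v} {x} {y} vxy∈ with ∈-cartesianProduct⁻ (filterᵇ (condensedᵖ S) (orderings m)) (filterᵇ (admissible S) allPairs) vxy∈
  ... | v∈ , xy∈ with ∈-filter⁻ (λ v → condensedᵖ S v Bool.≟ true) {xs = orderings m} v∈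
                    | ∈-filter⁻ (λ p → admissible S p Bool.≟ true) {xs = allPairs} xy∈
  ...   | v∈O , condensed | _ , adm with condensed-sound S v condensed | admissible-sound S x y adm
  ...     | i , j , covers | x∉S , y∉S , y≢x = record
    { i = i ; j = j ; ordered = ∈-orderings⁻ v v∈O ; four = four-of-cover S |S|≡4 covers
    ; x∉S = x∉S ; y∉S = y∉S ; y≢x = y≢x }

  restore : Fin n → Fin n → Pairing m × Tag → Pairing m
  restore x y (w , s , b , c , d) = relabel (λ z → transpose y d (transpose x b z)) w

  module Encoding {v x y} (W : Witness v x y) where
    open Witness W using (i; j; ordered; four; x∉S; y∉S; y≢x)
    open FourOf four

    s b c d : Fin n
    s = proj₁ (lookup v i)
    b = proj₂ (lookup v i)
    c = proj₁ (lookup v j)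
    d = proj₂ (lookup v j)

    σ : Fin n → Fin n
    σ z = transpose b x (transpose d y z)

    σ⁻¹∘σ : ∀ z → transpose y d (transpose x b (σ z)) ≡ z
    σ⁻¹∘σ z = trans (cong (transpose y d) (transpose-inverse x b {transpose d y z})) (transpose-inverse y d {z})

    σ-injective : ∀ {z z'} → σ z ≡ σ z' → z ≡ z'
    σ-injective {z} {z'} e = trans (sym (σ⁻¹∘σ z)) (trans (cong (λ u → transpose y d (transpose x b u)) e) (σ⁻¹∘σ z'))

    image : Pairing m
    image = relabel σ v

    encode : Pairing m × Tag
    encode = image , s , b , c , d

    σs : σ s ≡ s
    σs = trans (cong (transpose b x) (transpose-fixes d y s s≢d (inside≢outside S s∈S y∉S)))
               (transpose-fixes b x s s≢b (inside≢outside S s∈S x∉S))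
    σb : σ b ≡ x
    σb = trans (cong (transpose b x) (transpose-fixes d y b b≢d (inside≢outside S b∈S y∉S))) (transpose-source b x)
    σc : σ c ≡ c
    σc = trans (cong (transpose b x) (transpose-fixes d y c c≢d (inside≢outside S c∈S y∉S)))
               (transpose-fixes b x c (λ c≡b → b≢c (sym c≡b)) (inside≢outside S c∈S x∉S))
    σd : σ d ≡ y
    σd = trans (cong (transpose b x) (transpose-source d y))
               (transpose-fixes b x y (λ y≡b → inside≢outside S b∈S y∉S (sym y≡b)) y≢x)

    image-i : lookup image i ≡ (s , x)
    image-i = trans (lookup-relabel σ v i) (cong₂ _,_ σs σb)

    image-j : lookup image j ≡ (c , y)
    image-j = trans (lookup-relabel σ v j) (cong₂ _,_ σc σd)

    image-ordered : isOrderingᵇ image ≡ true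
    image-ordered = trans (isOrdering-relabel σ σ-injective v) ordered

    encode-∈ : encode ∈ Codomain
    encode-∈ = ∈-cartesianProduct⁺ (∈-orderings⁺ image image-ordered)
      (∈-cartesianProduct⁺ (∈-elements⁺ S s s∈S) (∈-cartesianProduct⁺ (∈-elements⁺ S b b∈S)
        (∈-cartesianProduct⁺ (∈-elements⁺ S c c∈S) (∈-elements⁺ S d d∈S))))

    recover : restore x y encode ≡ v
    recover = relabel-inverse σ _ σ⁻¹∘σ v

  open Encoding using (encode; image; image-i; image-j; image-ordered; encode-∈; recover)

  -- In the image, s and c locate the pairs (s , x) and (c , y); this
  -- determines x and y, and then the original ordering.
  encode-injective : ∀ {v x y v' x' y'} (W : Witness v x y) (W' : Witness v' x' y') →
                     encode W ≡ encode W' → (v , x , y) ≡ (v' , x' , y')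
  encode-injective {v} {x} {y} {v'} {x'} {y'} W W' same = cong₂ _,_ same-v (cong₂ _,_ same-x same-y)
    where
      open Witness using (i; j)
      same-image : image W ≡ image W'
      same-image = cong proj₁ same
      at-i' : lookup (image W) (i W') ≡ (Encoding.s W' , x')
      at-i' = trans (cong (λ u → lookup u (i W')) same-image) (image-i W')
      at-j' : lookup (image W) (j W') ≡ (Encoding.c W' , y')
      at-j' = trans (cong (λ u → lookup u (j W')) same-image) (image-j W')
      same-i : i W ≡ i W'
      same-i = first-determines-pair (image W) (image-ordered W) (i W) (i W')
        (trans (cong proj₁ (image-i W)) (trans (cong (λ t → proj₁ (proj₂ t)) same) (sym (cong proj₁ at-i'))))
      same-j : j W ≡ j W'
      same-j = first-determines-pair (image W) (image-ordered W) (j W) (j W')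
        (trans (cong proj₁ (image-j W)) (trans (cong (λ t → proj₁ (proj₂ (proj₂ (proj₂ t)))) same) (sym (cong proj₁ at-j'))))
      same-x : x ≡ x'
      same-x = cong proj₂ (trans (sym (image-i W)) (trans (cong (lookup (image W)) same-i) at-i'))
      same-y : y ≡ y'
      same-y = cong proj₂ (trans (sym (image-j W)) (trans (cong (lookup (image W)) same-j) at-j'))
      same-v : v ≡ v'
      same-v = begin
        v                             ≡⟨ sym (recover W) ⟩
        restore x y (encode W)        ≡⟨ cong₂ (λ xy t → restore (proj₁ xy) (proj₂ xy) t) (cong₂ _,_ same-x same-y) same ⟩
        restore x' y' (encode W')     ≡⟨ recover W' ⟩
        v' ∎
        where open ≡-Reasoning

  encodeᵈ : ∀ {p} → p ∈ Domain → Pairing m × Tag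
  encodeᵈ {v , x , y} p∈ = encode (witness p∈)

  encodeᵈ-∈ : ∀ {p} (p∈ : p ∈ Domain) → encodeᵈ p∈ ∈ Codomain
  encodeᵈ-∈ {v , x , y} p∈ = encode-∈ (witness p∈)

  encodeᵈ-injective : ∀ {p q} (p∈ : p ∈ Domain) (q∈ : q ∈ Domain) → encodeᵈ p∈ ≡ encodeᵈ q∈ → p ≡ q
  encodeᵈ-injective {v , x , y} {v' , x' , y'} p∈ q∈ = encode-injective (witness p∈) (witness q∈)

  Domain-unique : Unique Domain
  Domain-unique = cartesianProduct⁺ (filter⁺ _ (orderings-unique m)) (filter⁺ _ allPairs-unique)

  length-Domain : length Domain ≡ count (condensedᵖ S) (orderings m) * count (admissible S) allPairs
  length-Domain = trans (length-cartesianProduct (filterᵇ (condensedᵖ S) (orderings m)) (filterᵇ (admissible S) allPairs))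
    (cong₂ _*_ (length-filterᵇ (condensedᵖ S) (orderings m)) (length-filterᵇ (admissible S) allPairs))

  -- There are 4⁴ = 256 tags.
  length-Codomain : length Codomain ≡ length (orderings m) * 256
  length-Codomain = trans (length-cartesianProduct (orderings m) (E ⁴)) (cong (length (orderings m) *_) (begin
    length (E ⁴)                                   ≡⟨ length-cartesianProduct E (E ³) ⟩
    length E * length (E ³)                        ≡⟨ cong (length E *_) (length-cartesianProduct E (E ²)) ⟩
    length E * (length E * length (E ²))           ≡⟨ cong (λ k → length E * (length E * k)) (length-cartesianProduct E E) ⟩
    length E * (length E * (length E * length E))  ≡⟨ cong (λ k → k * (k * (k * k))) (trans (length-elements S) |S|≡4) ⟩
    256 ∎))
    where
      open ≡-Reasoning
      E : List (Fin n)
      E = elements S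
      _² _³ _⁴ : List (Fin n) → List _
      E ² = cartesianProduct E E
      E ³ = cartesianProduct E (E ²)
      E ⁴ = cartesianProduct E (E ³)

  condensed×admissible : count (condensedᵖ S) (orderings m) * count (admissible S) allPairs ≤ length (orderings m) * 256
  condensed×admissible = subst₂ _≤_ length-Domain length-Codomain
    (injection-length Domain-unique encodeᵈ (λ {p} → encodeᵈ-∈ {p}) (λ {p} {q} → encodeᵈ-injective {p} {q}))

  half-admissible : 18 ≤ n → n * n ≤ 2 * count (admissible S) allPairs
  half-admissible 18≤n = +-cancelˡ-≤ (18 * n) (n * n) (2 * X) (begin
    18 * n + n * n            ≤⟨ +-monoˡ-≤ (n * n) (*-monoˡ-≤ n 18≤n) ⟩
    n * n + n * n             ≡⟨ sym (double (n * n)) ⟩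
    2 * (n * n)               ≤⟨ *-monoʳ-≤ 2 (subst (λ k → n * n ≤ (k * n + n * suc k) + X) |S|≡4 (admissible-many S)) ⟩
    2 * ((4 * n + n * 5) + X) ≡⟨ expand n X ⟩
    18 * n + 2 * X ∎)
    where
      open ≤-Reasoning
      X : ℕ
      X = count (admissible S) allPairs
      double : ∀ k → 2 * k ≡ k + k
      double = solve-∀
      expand : ∀ n x → 2 * ((4 * n + n * 5) + x) ≡ 18 * n + 2 * x
      expand = solve-∀

  -- Hence P(S condensed) ≤ 2 · 256 / n² = 512 / n².
  condensed-estimate : 18 ≤ n → count (condensedᵖ S) (orderings m) * (n * n) ≤ 512 * length (orderings m)
  condensed-estimate 18≤n = begin
    A * (n * n)                      ≤⟨ *-monoʳ-≤ A (half-admissible 18≤n) ⟩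
    A * (2 * X)                      ≡⟨ regroup A X ⟩
    2 * (A * X)                      ≤⟨ *-monoʳ-≤ 2 condensed×admissible ⟩
    2 * (length (orderings m) * 256) ≡⟨ times-512 (length (orderings m)) ⟩
    512 * length (orderings m) ∎
    where
      open ≤-Reasoning
      A X : ℕ
      A = count (condensedᵖ S) (orderings m)
      X = count (admissible S) allPairs
      regroup : ∀ a x → a * (2 * x) ≡ 2 * (a * x)
      regroup = solve-∀
      times-512 : ∀ t → 2 * (t * 256) ≡ 512 * t
      times-512 = solve-∀

countCondensed-successes : ∀ {m} (H : ThreeGraph (2 * m)) (S : Subset (2 * m)) {r} (t : Vec (Pairing m) r) →
  countCondensed S (map (procedure3 H) (toList t)) ≡ Trials.successes (orderings m) (condensedᵖ S) t
countCondensed-successes H S []      = refl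
countCondensed-successes H S (v ∷ t) =
  cong₂ _+_ (cong (λ b → if b then 1 else 0) (condensed-procedure3 H S v)) (countCondensed-successes H S t)

union-bound : ∀ m r (H : ThreeGraph (2 * m)) → 18 ≤ 2 * m →
  badCount m r H * (2 * m * (2 * m)) ^ 10 ≤ (2 * m) ^ 4 * (r ^ 10 * 512 ^ 10 * length (orderings m) ^ r)
union-bound m r H 18≤n = begin
  badCount m r H * Z
    ≡⟨ cong (_* Z) (length-filterᵇ (badᵇ H) (tuples m r)) ⟩
  count (badᵇ H) (tuples m r) * Z
    ≤⟨ *-monoˡ-≤ Z (count-any condensed-often (fourSets n) (tuples m r)) ⟩
  sum (map (λ S → count (condensed-often S) (tuples m r)) (fourSets n)) * Z
    ≡⟨ sum-*ʳ (λ S → count (condensed-often S) (tuples m r)) Z (fourSets n) ⟩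
  sum (map (λ S → count (condensed-often S) (tuples m r) * Z) (fourSets n))
    ≤⟨ sum-≤ _ _ (fourSets n) one-set ⟩
  length (fourSets n) * bound
    ≤⟨ *-monoˡ-≤ bound (length-fourSets n) ⟩
  n ^ 4 * bound ∎
  where
    open ≤-Reasoning
    n Z bound : ℕ
    n = 2 * m
    Z = (n * n) ^ 10
    bound = r ^ 10 * 512 ^ 10 * length (orderings m) ^ r
    condensed-often : Subset n → Vec (Pairing m) r → Bool
    condensed-often S t = 10 ≤ᵇ countCondensed S (map (procedure3 H) (toList t))
    one-set : ∀ S → S ∈ fourSets n → count (condensed-often S) (tuples m r) * Z ≤ bound
    one-set S S∈ = begin
      count (condensed-often S) (tuples m r) * Z
        ≡⟨ cong (_* Z) (count-cong (λ t → cong (10 ≤ᵇ_) (countCondensed-successes H S t)) (tuples m r)) ⟩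
      Trials.atLeast (orderings m) (condensedᵖ S) r 10 * Z
        ≤⟨ Trials.tail-bound (orderings m) (condensedᵖ S) (n * n) 512
             (CondensedOrderings.condensed-estimate m S (∈-fourSets⁻ S S∈) 18≤n) r 10 ⟩
      bound ∎

^-distribʳ-* : ∀ a b k → (a * b) ^ k ≡ a ^ k * b ^ k
^-distribʳ-* a b zero    = refl
^-distribʳ-* a b (suc k) = trans (cong (a * b *_) (^-distribʳ-* a b k)) (interchange a b (a ^ k) (b ^ k))
  where
    interchange : ∀ a b x y → a * b * (x * y) ≡ a * x * (b * y)
    interchange = solve-∀

-- If B n²⁰ ≤ n⁴ (ac)^10 T and K c² a² ≤ n³, then K n B ≤ T: with
-- B/T = P(bad), c = 512 and a = r this is n · P(bad) ≤ 1/K.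
failure-bound : ∀ k n c a B T .{{_ : NonZero n}} → suc k * c ^ 2 * a ^ 2 ≤ n ^ 3 →
                B * (n * n) ^ 10 ≤ n ^ 4 * (a ^ 10 * c ^ 10 * T) → suc k * n * B ≤ T
failure-bound k n c a B T small union = *-cancelʳ-≤ (K * n * B) T ((n * n) ^ 10) {{m^n≢0 (n * n) 10 {{m*n≢0 n n}}}} (begin
  K * n * B * (n * n) ^ 10                ≡⟨ *-assoc (K * n) B ((n * n) ^ 10) ⟩
  K * n * (B * (n * n) ^ 10)              ≤⟨ *-monoʳ-≤ (K * n) union ⟩
  K * n * (n ^ 4 * (a ^ 10 * c ^ 10 * T)) ≡⟨ collect K n (n ^ 4) (a ^ 10 * c ^ 10) T ⟩
  n ^ 5 * (K * (a ^ 10 * c ^ 10)) * T     ≤⟨ *-monoˡ-≤ T (*-monoʳ-≤ (n ^ 5) K-small) ⟩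
  n ^ 5 * n ^ 15 * T                      ≡⟨ n²⁰ ⟩
  T * (n * n) ^ 10 ∎)
  where
    open ≤-Reasoning
    K : ℕ
    K = suc k
    collect : ∀ K n n⁴ P T → K * n * (n⁴ * (P * T)) ≡ n * n⁴ * (K * P) * T
    collect = solve-∀
    fifth-power : (K * c ^ 2 * a ^ 2) ^ 5 ≡ K ^ 5 * (a ^ 10 * c ^ 10)
    fifth-power = begin-equality
      (K * c ^ 2 * a ^ 2) ^ 5           ≡⟨ ^-distribʳ-* (K * c ^ 2) (a ^ 2) 5 ⟩
      (K * c ^ 2) ^ 5 * (a ^ 2) ^ 5     ≡⟨ cong (_* (a ^ 2) ^ 5) (^-distribʳ-* K (c ^ 2) 5) ⟩
      K ^ 5 * (c ^ 2) ^ 5 * (a ^ 2) ^ 5 ≡⟨ cong₂ (λ u v → K ^ 5 * u * v) (^-*-assoc c 2 5) (^-*-assoc a 2 5) ⟩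
      K ^ 5 * c ^ 10 * a ^ 10           ≡⟨ *-assoc (K ^ 5) (c ^ 10) (a ^ 10) ⟩
      K ^ 5 * (c ^ 10 * a ^ 10)         ≡⟨ cong (K ^ 5 *_) (*-comm (c ^ 10) (a ^ 10)) ⟩
      K ^ 5 * (a ^ 10 * c ^ 10) ∎
    K-small : K * (a ^ 10 * c ^ 10) ≤ n ^ 15
    K-small = begin
      K * (a ^ 10 * c ^ 10)       ≤⟨ *-monoˡ-≤ (a ^ 10 * c ^ 10) (m≤m*n K (K ^ 4) {{m^n≢0 K 4}}) ⟩
      K ^ 5 * (a ^ 10 * c ^ 10)   ≡⟨ sym fifth-power ⟩
      (K * c ^ 2 * a ^ 2) ^ 5     ≤⟨ ^-monoˡ-≤ 5 small ⟩
      (n ^ 3) ^ 5                 ≡⟨ ^-*-assoc n 3 5 ⟩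
      n ^ 15 ∎
    n²⁰ : n ^ 5 * n ^ 15 * T ≡ T * (n * n) ^ 10
    n²⁰ = begin-equality
      n ^ 5 * n ^ 15 * T   ≡⟨ cong (_* T) (sym (^-distribˡ-+-* n 5 15)) ⟩
      n ^ 20 * T           ≡⟨ *-comm (n ^ 20) T ⟩
      T * n ^ 20           ≡⟨ cong (T *_) (trans (^-distribˡ-+-* n 10 10) (sym (^-distribʳ-* n n 10))) ⟩
      T * (n * n) ^ 10 ∎

-- Lemma 4.5.  Take N = N₀ + 18 where r² ≤ n³ / ((k+1)·512²) for n ≥ N₀;
-- then n ≥ 18, and union-bound with failure-bound gives (k+1)·n·P(bad) ≤ 1.
lemma4p5 : (r : ℕ → ℕ)
    → (∀ k → ∃ λ N → ∀ n → n ≥ N → suc k * r n ^ 2 ≤ n ^ 3)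
    → (H : (m : ℕ) → ThreeGraph (2 * m))
    → ∀ k → ∃ λ N → ∀ m → 2 * m ≥ N
    → suc k * (2 * m) * badCount m (r (2 * m)) (H m) ≤ length (tuples m (r (2 * m)))
lemma4p5 r r²≪n³ H k = N₀ + 18 , λ m N≤n →
  let n : ℕ
      n = 2 * m
      18≤n : 18 ≤ n
      18≤n = ≤-trans (m≤n+m 18 N₀) N≤n
      small : suc k * 512 ^ 2 * r n ^ 2 ≤ n ^ 3
      small = ≤-trans (*-monoˡ-≤ (r n ^ 2) (n≤1+n (suc k * 512 ^ 2))) (r-small n (≤-trans (m≤m+n N₀ 18) N≤n))
  in subst (suc k * n * badCount m (r n) (H m) ≤_) (sym (length-allVec (r n) (orderings m)))
       (failure-bound k n 512 (r n) (badCount m (r n) (H m)) (length (orderings m) ^ r n)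
          {{>-nonZero (≤-trans (s≤s z≤n) 18≤n)}} small (union-bound m (r n) (H m) 18≤n))
  where
    N₀ : ℕ
    N₀ = proj₁ (r²≪n³ (suc k * 512 ^ 2))
    r-small : ∀ n → n ≥ N₀ → suc (suc k * 512 ^ 2) * r n ^ 2 ≤ n ^ 3
    r-small = proj₂ (r²≪n³ (suc k * 512 ^ 2))
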